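{- If $\mathbf{\Omega}$ is an integral chain, $f\in F(\mathbf{\Omega})$, $a\in\Omega$, $m\in\mathbb{Z}$, $\mathbf{\Delta}$ is a sub c-chain of $(\mathbf{\Omega},\prec)$ containing $\Delta^a_{f,m}$, and $g$ is an order-preserving partial function over $\mathbf{\Delta}$ such that $g|_{\Lambda^a_{f,m}}=f|_{\Lambda^a_{f,m}}$, then $g^{[m]}(a)=f^{(m)}(a)$.
   Context: A chain $\mathbf{\Omega}$ is integral if every element lies in an interval isomorphic to $\mathbb{Z}$; $-b$ and $+b$ denote the lower and upper cover of $b$, and $\prec$ the covering relation. $F(\mathbf{\Omega})$ is the set of order-preserving maps on $\mathbf{\Omega}$ having residuals and dual residuals of all orders; $f^{(0)}=f$, $f^{(m)}=f^{\ell^m}$ (iterated dual residual, $f^{\ell}(x)=\min\{b:x\leq f(b)\}$) and $f^{(-m)}=f^{r^m}$ (iterated residual, $f^{r}(x)=\max\{b:f(b)\leq x\}$) for $m\in\mathbb{Z}^+$. For $m\in\mathbb{N}$: $\Lambda^a_{f,m}=\{\sigma_1f^{(1)}\cdots\sigma_mf^{(m)}(a):\sigma_1,\ldots,\sigma_m\in\{ -1,0\}\}$ and $\Delta^a_{f,m}=\{a\}\cup\bigcup_{j=0}^m\{\sigma_jf^{(j)}\cdots\sigma_mf^{(m)}(a):\sigma_j,\ldots,\sigma_m\in\{ -1,0\},\sigma_0=0\}$; $\Lambda^a_{f,-m}$ and $\Delta^a_{f,-m}$ are defined likewise with $f^{(-1)},\ldots,f^{(-m)}$ and $\sigma$'s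 in $\{1,0\}$. Here $\sigma=-1$ applies the lower-cover map, $\sigma=1$ the upper-cover map, and $\sigma=0$ the identity; for $m=0$, $\Lambda^a_{f,0}=\{a\}$ and $\Delta^a_{f,0}=\{a,f(a)\}$. A c-chain is a triple $(\Delta,\leq,\lessdot)$ with $(\Delta,\leq)$ a finite chain and $\lessdot$ a subset of its covering relation; a sub c-chain of $(\mathbf{\Omega},\prec)$ is a finite subset $\Delta\subseteq\Omega$ with the restricted order and with $\lessdot$ the restriction of the covering relation $\prec$ of $\mathbf{\Omega}$. For an order-preserving partial function $g$ on a c-chain: $(x,b)\in g^{[\ell]}$ iff $b\in Dom(g)$ and some $a\in Dom(g)$ has $a\lessdot b$ and $g(a)<x\leq g(b)$; $(x,a)\in g^{[r]}$ iff $a\in Dom(g)$ and some $b\in Dom(g)$ has $a\lessdot b$ and $g(a)\leq x<g(b)$; $g^{[0]}=g$, $g^{[k+1]}=(g^{[k]})^{[\ell]}$, $g^{[-(k+1)]}=(g^{[-k]})^{[r]}$. -}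

module Defs where

open import Data.Nat using (ℕ; zero; suc; _≤_)
open import Data.Integer as ℤ using (ℤ; +_; -[1+_]; -_)
open import Data.Product using (Σ; _×_; ∃; Σ-syntax)
open import Data.Sum using (_⊎_)
open import Data.Empty using (⊥)
open import Data.List using (List)
open import Data.List.Membership.Propositional using (_∈_)
open import Relation.Binary.PropositionalEquality using (_≡_; _≢_)

-- Tail h c a n j  is the set  { σ_j h_j ( σ_{j+1} h_{j+1} ( ... σ_n h_n (a))) }
-- where each σ_i is either the identity or the cover map c.
-- (Tail h c a n (suc n) = {a}.)
data Tail {Ω : Set} (h : ℕ → Ω → Ω) (c : Ω → Ω) (a : Ω) (n : ℕ) : ℕ → Ω → Set where
  base  : Tail h c a n (suc n) a
  keep  : ∀ {j x} → Tail h c a n (suc j) x → Tail h c a n j (h j x)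
  cover : ∀ {j x} → Tail h c a n (suc j) x → Tail h c a n j (c (h j x))

LamG : {Ω : Set} → (ℕ → Ω → Ω) → (Ω → Ω) → Ω → ℕ → Ω → Set
LamG h c a n x = Tail h c a n 1 x

DelG : {Ω : Set} → (ℕ → Ω → Ω) → (Ω → Ω) → Ω → ℕ → Ω → Set
DelG h c a n x =
  (x ≡ a)
  ⊎ (Σ[ j ∈ ℕ ] (1 ≤ j × Tail h c a n j x))
  ⊎ (Σ[ y ∈ _ ] (Tail h c a n 1 y × x ≡ h 0 y))

-- Λ^a_{f,m} and Δ^a_{f,m}, where fs m = f^{(m)}, lc = lower cover (−b),
-- uc = upper cover (+b).
Lam : {Ω : Set} → (ℤ → Ω → Ω) → (lc uc : Ω → Ω) → Ω → ℤ → Ω → Set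
Lam fs lc uc a (+ n)     = LamG (λ k → fs (+ k)) lc a n
Lam fs lc uc a -[1+ n ]  = LamG (λ k → fs (- (+ k))) uc a (suc n)

Del : {Ω : Set} → (ℤ → Ω → Ω) → (lc uc : Ω → Ω) → Ω → ℤ → Ω → Set
Del fs lc uc a (+ n)     = DelG (λ k → fs (+ k)) lc a n
Del fs lc uc a -[1+ n ]  = DelG (λ k → fs (- (+ k))) uc a (suc n)

module _ {Ω : Set} (_≼_ : Ω → Ω → Set) where

  Strict : Ω → Ω → Set
  Strict x y = x ≼ y × x ≢ y

  Cov : Ω → Ω → Set
  Cov a b = Strict a b × (∀ c → Strict a c → Strict c b → ⊥)

  -- integral chain: every element lies in an interval (convex subset)
  -- order-isomorphic to ℤ
  Integral : Set
  Integral = ∀ (a : Ω) → Σ[ φ ∈ (ℤ → Ω) ]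
      ((∀ i j → (i ℤ.≤ j → φ i ≼ φ j) × (φ i ≼ φ j → i ℤ.≤ j))
     × (∀ i j x → φ i ≼ x → x ≼ φ j → ∃ λ k → φ k ≡ x)
     × (∃ λ k → φ k ≡ a))

  Monotone : (Ω → Ω) → Set
  Monotone f = ∀ x y → x ≼ y → f x ≼ f y

  IsResidual : (Ω → Ω) → (Ω → Ω) → Set
  IsResidual f g = ∀ x → (f (g x) ≼ x) × (∀ b → f b ≼ x → b ≼ g x)

  IsDualResidual : (Ω → Ω) → (Ω → Ω) → Set
  IsDualResidual f g = ∀ x → (x ≼ f (g x)) × (∀ b → x ≼ f b → g x ≼ b)

  -- f ∈ F(Ω), witnessed by the (unique) tower fs m = f^{(m)}
  record InF (f : Ω → Ω) : Set where
    field
      mono  : Monotone f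
      fs    : ℤ → Ω → Ω
      fs0   : ∀ x → fs (+ 0) x ≡ f x
      dres  : ∀ n → IsDualResidual (fs (+ n)) (fs (+ suc n))
      res   : ∀ n → IsResidual (fs (- (+ n))) (fs -[1+ n ])

  CovIn : List Ω → Ω → Ω → Set
  CovIn Δ a b = a ∈ Δ × b ∈ Δ × Cov a b

  -- G (as a graph: G x y means g(x) = y) is an order-preserving
  -- partial function over Δ
  IsOPPartialFun : List Ω → (Ω → Ω → Set) → Set
  IsOPPartialFun Δ G =
      (∀ x y → G x y → x ∈ Δ × y ∈ Δ)
    × (∀ x y y′ → G x y → G x y′ → y ≡ y′)
    × (∀ x x′ y y′ → G x y → G x′ y′ → x ≼ x′ → y ≼ y′)

  -- g^{[ℓ]} : (x , b) ∈ g^{[ℓ]}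
  ellStep : List Ω → (Ω → Ω → Set) → Ω → Ω → Set
  ellStep Δ G x b = x ∈ Δ × Σ[ a ∈ Ω ] Σ[ ya ∈ Ω ] Σ[ yb ∈ Ω ]
    (G a ya × G b yb × CovIn Δ a b × Strict ya x × x ≼ yb)

  -- g^{[r]} : (x , a) ∈ g^{[r]}
  rStep : List Ω → (Ω → Ω → Set) → Ω → Ω → Set
  rStep Δ G x a = x ∈ Δ × Σ[ b ∈ Ω ] Σ[ ya ∈ Ω ] Σ[ yb ∈ Ω ]
    (G a ya × G b yb × CovIn Δ a b × ya ≼ x × Strict x yb)

  ellIt : List Ω → (Ω → Ω → Set) → ℕ → Ω → Ω → Set
  ellIt Δ G zero    = G
  ellIt Δ G (suc k) = ellStep Δ (ellIt Δ G k)

  rIt : List Ω → (Ω → Ω → Set) → ℕ → Ω → Ω → Set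
  rIt Δ G zero    = G
  rIt Δ G (suc k) = rStep Δ (rIt Δ G k)

  gIter : List Ω → (Ω → Ω → Set) → ℤ → Ω → Ω → Set
  gIter Δ G (+ n)    = ellIt Δ G n
  gIter Δ G -[1+ n ] = rIt Δ G (suc n)

{-# OPTIONS --safe #-}
-- For m = n + 1 put B = f⁽ⁿ⁺¹⁾(a). The induction hypothesis, applied at B
-- and at −B (whose Δ's and Λ's sit inside those of a), gives g^[n](B) = f⁽ⁿ⁾(B) and
-- g^[n](−B) = f⁽ⁿ⁾(−B). Since −B ⋖ B and f⁽ⁿ⁾(−B) < a ≤ f⁽ⁿ⁾(B) by the dual-residual
-- property, (a, B) ∈ g^[n+1], and monotonicity of g^[n] rules out any other value.
-- Negative m is dual. Integrality is used only to decide equality of elements, which makes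
-- the chain trichotomous.
module Submission where

open import Defs
open import Data.Nat using (ℕ; zero; suc; s≤s; z≤n)
open import Data.Integer using (ℤ; +_; -[1+_]; -_)
import Data.Integer as ℤ
import Data.Integer.Properties as ℤ
open import Data.Product using (_×_; _,_; proj₁; proj₂)
open import Data.Sum using (_⊎_; inj₁; inj₂)
open import Data.Empty using (⊥-elim)
open import Data.List using (List)
open import Data.List.Membership.Propositional using (_∈_)
open import Function using (_∘_)
open import Relation.Nullary using (¬_; yes; no)
open import Relation.Binary.Definitions using (DecidableEquality; Trichotomous; tri<; tri≈; tri>)
open import Relation.Binary.PropositionalEquality using (_≡_; refl; sym; trans; subst)
open import Relation.Binary.Structures using (IsTotalOrder)
import Relation.Binary.Construct.NonStrictToStrict as NonStrictToStrict

Tail-graft : ∀ {Ω : Set} {h : ℕ → Ω → Ω} {c : Ω → Ω} {b b′ : Ω} {n j x} →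
             Tail h c b (suc n) (suc n) b′ → Tail h c b′ n j x → Tail h c b (suc n) j x
Tail-graft t base      = t
Tail-graft t (keep s)  = keep (Tail-graft t s)
Tail-graft t (cover s) = cover (Tail-graft t s)

DelG-graft : ∀ {Ω : Set} {h : ℕ → Ω → Ω} {c : Ω → Ω} {b b′ : Ω} {n x} →
             Tail h c b (suc n) (suc n) b′ → DelG h c b′ n x → DelG h c b (suc n) x
DelG-graft t (inj₁ refl)                = inj₂ (inj₁ (_ , s≤s z≤n , t))
DelG-graft t (inj₂ (inj₁ (j , 1≤j , s))) = inj₂ (inj₁ (j , 1≤j , Tail-graft t s))
DelG-graft t (inj₂ (inj₂ (y , s , eq)))  = inj₂ (inj₂ (y , Tail-graft t s , eq))

module Chain {Ω : Set} {_≼_ : Ω → Ω → Set} (isTotalOrder : IsTotalOrder _≡_ _≼_) where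

  open IsTotalOrder isTotalOrder using (total; antisym; reflexive)
    renaming (refl to ≼-refl; trans to ≼-trans)
  open NonStrictToStrict _≡_ _≼_ using (_<_; <⇒≱)

  MonotoneRel : (Ω → Ω → Set) → Set
  MonotoneRel G = ∀ x x′ y y′ → G x y → G x′ y′ → x ≼ x′ → y ≼ y′

  ≰⇒> : ∀ {x y} → ¬ (x ≼ y) → y < x
  ≰⇒> {x} {y} x≰y with total x y
  ... | inj₁ x≤y = ⊥-elim (x≰y x≤y)
  ... | inj₂ y≤x = y≤x , λ { refl → x≰y ≼-refl }

  reflecting⇒injective : (φ : ℤ → Ω) → (∀ i j → φ i ≼ φ j → i ℤ.≤ j) →
                         ∀ {i j} → φ i ≡ φ j → i ≡ j
  reflecting⇒injective φ reflects {i} {j} φi≡φj =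
    ℤ.≤-antisym (reflects i j (reflexive φi≡φj)) (reflects j i (reflexive (sym φi≡φj)))

  dualResidual-below : ∀ {h h′} (c : Ω → Ω) → (∀ b → c b < b) → IsDualResidual _≼_ h h′ →
                       ∀ b → h (c (h′ b)) < b
  dualResidual-below c c< dres b = ≰⇒> λ b≤ → <⇒≱ antisym (c< _) (proj₂ (dres b) _ b≤)

  residual-above : ∀ {h h′} (c : Ω → Ω) → (∀ b → b < c b) → IsResidual _≼_ h h′ →
                   ∀ b → b < h (c (h′ b))
  residual-above c <c res b = ≰⇒> λ ≤b → <⇒≱ antisym (<c _) (proj₂ (res b) _ ≤b)

  module Integrality (integral : Integral _≼_) where

    -- Within the copy of ℤ through x, y is either beyond the successor of x or has an index,
    -- and indices have decidable equality.
    ≼⇒≡⊎< : ∀ {x y} → x ≼ y → x ≡ y ⊎ x < y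
    ≼⇒≡⊎< {x} {y} x≤y with integral x
    ... | φ , ord , convex , i , refl with total y (φ (ℤ.suc i))
    ...   | inj₂ φ[1+i]≤y = inj₂ (x≤y , λ { refl →
              ℤ.i≢suc[i] (ℤ.≤-antisym (ℤ.i≤suc[i] i) (proj₂ (ord (ℤ.suc i) i) φ[1+i]≤y)) })
    ...   | inj₁ y≤φ[1+i] with convex i (ℤ.suc i) y x≤y y≤φ[1+i]
    ...     | k , refl with k ℤ.≟ i
    ...       | yes refl = inj₁ refl
    ...       | no k≢i   =
      inj₂ (x≤y , k≢i ∘ reflecting⇒injective φ (λ i j → proj₂ (ord i j)) ∘ sym)

    _≟_ : DecidableEquality Ω
    x ≟ y with total x y
    ... | inj₁ x≤y with ≼⇒≡⊎< x≤y
    ...   | inj₁ x≡y = yes x≡y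
    ...   | inj₂ x<y = no (proj₂ x<y)
    x ≟ y | inj₂ y≤x with ≼⇒≡⊎< y≤x
    ...   | inj₁ y≡x = yes (sym y≡x)
    ...   | inj₂ y<x = no (proj₂ y<x ∘ sym)

    open NonStrictToStrict _≡_ _≼_ using (<-trichotomous)

    compare : Trichotomous _≡_ _<_
    compare = <-trichotomous sym _≟_ antisym total

    ≯⇒≤ : ∀ {x y} → ¬ (y < x) → x ≼ y
    ≯⇒≤ {x} {y} y≮x with compare x y
    ... | tri< x<y _ _ = proj₁ x<y
    ... | tri≈ _ x≡y _ = reflexive x≡y
    ... | tri> _ _ y<x = ⊥-elim (y≮x y<x)

    Cov⇒≼-below : ∀ {p q r} → Cov _≼_ p q → r < q → r ≼ p
    Cov⇒≼-below (_ , nothing-between) r<q = ≯⇒≤ λ p<r → nothing-between _ p<r r<q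

    Cov⇒≼-above : ∀ {p q r} → Cov _≼_ p q → p < r → q ≼ r
    Cov⇒≼-above (_ , nothing-between) p<r = ≯⇒≤ λ r<q → nothing-between _ p<r r<q

    ellStep-mono : ∀ Δ {G} → MonotoneRel G → MonotoneRel (ellStep _≼_ Δ G)
    ellStep-mono Δ mono x x′ b b′ (_ , a , ga , _ , Ga , _ , (_ , _ , a⋖b) , ga<x , _)
      (_ , _ , _ , gb′ , _ , Gb′ , _ , _ , x′≤gb′) x≤x′ = ≯⇒≤ λ b′<b →
      <⇒≱ antisym ga<x
        (≼-trans x≤x′ (≼-trans x′≤gb′ (mono b′ a gb′ ga Gb′ Ga (Cov⇒≼-below a⋖b b′<b))))

    rStep-mono : ∀ Δ {G} → MonotoneRel G → MonotoneRel (rStep _≼_ Δ G)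
    rStep-mono Δ mono x x′ a a′ (_ , _ , ga , _ , Ga , _ , _ , ga≤x , _)
      (_ , b′ , _ , gb′ , _ , Gb′ , (_ , _ , a′⋖b′) , _ , x′<gb′) x≤x′ = ≯⇒≤ λ a′<a →
      <⇒≱ antisym x′<gb′
        (≼-trans (mono b′ a gb′ ga Gb′ Ga (Cov⇒≼-above a′⋖b′ a′<a)) (≼-trans ga≤x x≤x′))

    ellIt-mono : ∀ Δ {G} → MonotoneRel G → ∀ n → MonotoneRel (ellIt _≼_ Δ G n)
    ellIt-mono Δ mono zero    = mono
    ellIt-mono Δ mono (suc n) = ellStep-mono Δ (ellIt-mono Δ mono n)

    rIt-mono : ∀ Δ {G} → MonotoneRel G → ∀ n → MonotoneRel (rIt _≼_ Δ G n)
    rIt-mono Δ mono zero    = mono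
    rIt-mono Δ mono (suc n) = rStep-mono Δ (rIt-mono Δ mono n)

    ellStep-unique : ∀ {Δ G p q u v x y} → MonotoneRel G → Cov _≼_ p q → G p u → G q v →
                     u < x → x ≼ v → ellStep _≼_ Δ G x y → y ≡ q
    ellStep-unique {p = p} {q} {u} {v} {y = y} mono p⋖q Gpu Gqv u<x x≤v
      (_ , a , ga , gy , Ga , Gy , (_ , _ , a⋖y) , ga<x , x≤gy) = antisym y≤q q≤y
      where
      y≤q : y ≼ q
      y≤q = ≯⇒≤ λ q<y →
        <⇒≱ antisym ga<x (≼-trans x≤v (mono q a v ga Gqv Ga (Cov⇒≼-below a⋖y q<y)))
      q≤y : q ≼ y
      q≤y = ≯⇒≤ λ y<q →
        <⇒≱ antisym u<x (≼-trans x≤gy (mono y p gy u Gy Gpu (Cov⇒≼-below p⋖q y<q)))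

    rStep-unique : ∀ {Δ G p q u v x y} → MonotoneRel G → Cov _≼_ p q → G p u → G q v →
                   u ≼ x → x < v → rStep _≼_ Δ G x y → y ≡ p
    rStep-unique {p = p} {q} {u} {v} {y = y} mono p⋖q Gpu Gqv u≤x x<v
      (_ , b , gy , gb , Gy , Gb , (_ , _ , y⋖b) , gy≤x , x<gb) = antisym y≤p p≤y
      where
      y≤p : y ≼ p
      y≤p = ≯⇒≤ λ p<y →
        <⇒≱ antisym x<v (≼-trans (mono q y v gy Gqv Gy (Cov⇒≼-above p⋖q p<y)) gy≤x)
      p≤y : p ≼ y
      p≤y = ≯⇒≤ λ y<p →
        <⇒≱ antisym x<gb (≼-trans (mono b p gb u Gb Gpu (Cov⇒≼-above y⋖b y<p)) u≤x)

    module Tower (lc uc : Ω → Ω)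
                 (lc⋖ : ∀ b → Cov _≼_ (lc b) b) (⋖uc : ∀ b → Cov _≼_ b (uc b))
                 {f : Ω → Ω} (F : InF _≼_ f) {Δ : List Ω} {G : Ω → Ω → Set}
                 (isOP : IsOPPartialFun _≼_ Δ G) where

      open InF F

      f⁺ f⁻ : ℕ → Ω → Ω
      f⁺ k = fs (+ k)
      f⁻ k = fs (- (+ k))

      Admissible : (ℕ → Ω → Ω) → (Ω → Ω) → ℕ → Ω → Set
      Admissible h c n b =
        (∀ x → DelG h c b n x → x ∈ Δ) × (∀ x → LamG h c b n x → G x (f x))

      graft : ∀ {h c n b b′} → Tail h c b (suc n) (suc n) b′ →
              Admissible h c (suc n) b → Admissible h c n b′
      graft t (inΔ , agree) = (λ x → inΔ x ∘ DelG-graft t) , (λ x → agree x ∘ Tail-graft t)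

      ∈Δ-tail : ∀ {h c n b x} → Admissible h c (suc n) b →
                Tail h c b (suc n) (suc n) x → x ∈ Δ
      ∈Δ-tail (inΔ , _) t = inΔ _ (inj₂ (inj₁ (_ , s≤s z≤n , t)))

      G-mono : MonotoneRel G
      G-mono = proj₂ (proj₂ isOP)

      G-at-f⁰ : ∀ {h c} b → Admissible h c 0 b → G b (fs (+ 0) b)
      G-at-f⁰ b (_ , agree) = subst (G b) (sym (fs0 b)) (agree b base)

      G-unique-f⁰ : ∀ {h c} b → Admissible h c 0 b → ∀ y → G b y → y ≡ fs (+ 0) b
      G-unique-f⁰ b (_ , agree) y Gby =
        trans (proj₁ (proj₂ isOP) b y (f b) Gby (agree b base)) (sym (fs0 b))

      ellIt-attains : ∀ n b → Admissible f⁺ lc n b → ellIt _≼_ Δ G n b (f⁺ n b)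
      ellIt-attains zero    b adm = G-at-f⁰ b adm
      ellIt-attains (suc n) b adm =
        proj₁ adm b (inj₁ refl) , lc B , f⁺ n (lc B) , f⁺ n B ,
        ellIt-attains n (lc B) (graft (cover base) adm) ,
        ellIt-attains n B (graft (keep base) adm) ,
        (∈Δ-tail adm (cover base) , ∈Δ-tail adm (keep base) , lc⋖ B) ,
        dualResidual-below lc (proj₁ ∘ lc⋖) (dres n) b , proj₁ (dres n b)
        where B = f⁺ (suc n) b

      ellIt-unique : ∀ n b → Admissible f⁺ lc n b → ∀ y → ellIt _≼_ Δ G n b y → y ≡ f⁺ n b
      ellIt-unique zero    b adm = G-unique-f⁰ b adm
      ellIt-unique (suc n) b adm _ =
        ellStep-unique (ellIt-mono Δ G-mono n) (lc⋖ B)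
          (ellIt-attains n (lc B) (graft (cover base) adm))
          (ellIt-attains n B (graft (keep base) adm))
          (dualResidual-below lc (proj₁ ∘ lc⋖) (dres n) b) (proj₁ (dres n b))
        where B = f⁺ (suc n) b

      rIt-attains : ∀ n b → Admissible f⁻ uc n b → rIt _≼_ Δ G n b (f⁻ n b)
      rIt-attains zero    b adm = G-at-f⁰ b adm
      rIt-attains (suc n) b adm =
        proj₁ adm b (inj₁ refl) , uc A , f⁻ n A , f⁻ n (uc A) ,
        rIt-attains n A (graft (keep base) adm) ,
        rIt-attains n (uc A) (graft (cover base) adm) ,
        (∈Δ-tail adm (keep base) , ∈Δ-tail adm (cover base) , ⋖uc A) ,
        proj₁ (res n b) , residual-above uc (proj₁ ∘ ⋖uc) (res n) b
        where A = f⁻ (suc n) b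

      rIt-unique : ∀ n b → Admissible f⁻ uc n b → ∀ y → rIt _≼_ Δ G n b y → y ≡ f⁻ n b
      rIt-unique zero    b adm = G-unique-f⁰ b adm
      rIt-unique (suc n) b adm _ =
        rStep-unique (rIt-mono Δ G-mono n) (⋖uc A)
          (rIt-attains n A (graft (keep base) adm))
          (rIt-attains n (uc A) (graft (cover base) adm))
          (proj₁ (res n b)) (residual-above uc (proj₁ ∘ ⋖uc) (res n) b)
        where A = f⁻ (suc n) b

lemma3p4 : {Ω : Set} (_≼_ : Ω → Ω → Set) → IsTotalOrder _≡_ _≼_ → Integral _≼_
    → (lc uc : Ω → Ω) → (∀ b → Cov _≼_ (lc b) b) → (∀ b → Cov _≼_ b (uc b))
    → (f : Ω → Ω) (F : InF _≼_ f) (a : Ω) (m : ℤ) (Δ : List Ω)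
    → (∀ x → Del (InF.fs F) lc uc a m x → x ∈ Δ)
    → (G : Ω → Ω → Set) → IsOPPartialFun _≼_ Δ G
    → (∀ x → Lam (InF.fs F) lc uc a m x → G x (f x))
    → gIter _≼_ Δ G m a (InF.fs F m a)
      × (∀ y → gIter _≼_ Δ G m a y → y ≡ InF.fs F m a)
lemma3p4 _≼_ isTotalOrder integral lc uc lc⋖ ⋖uc f F a (+ n) Δ inΔ G isOP agree =
  ellIt-attains n a (inΔ , agree) , ellIt-unique n a (inΔ , agree)
  where open Chain.Integrality isTotalOrder integral
        open Tower lc uc lc⋖ ⋖uc F isOP
lemma3p4 _≼_ isTotalOrder integral lc uc lc⋖ ⋖uc f F a -[1+ n ] Δ inΔ G isOP agree =
  rIt-attains (suc n) a (inΔ , agree) , rIt-unique (suc n) a (inΔ , agree)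
  where open Chain.Integrality isTotalOrder integral
        open Tower lc uc lc⋖ ⋖uc F isOP
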